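{- Consider a Slick hash table with parameters $m, B, \hat{B}, \hat{o}, \hat{t}$ (notation in the context). A call of the operation $\mathrm{insert}(e)$ takes time $O(\hat{B}+s)+T_{\mathrm{bump}}$, where $s$ is the number of blocks considered by the call (i.e. the blocks scanned and slid by the procedures that search left and right for a free slot), and $T_{\mathrm{bump}}$ is the time spent on operations in the backyard.
   Context: Model: word RAM with constant-time operations on $O(\log n)$-bit words; hash functions are assumed truly random. A Slick hash table stores a set $S$ of $n$ key-value pairs (elements) with distinct keys. It consists of a main array $T[0..m-1]$ of elements, a backyard $T'$ (an arbitrary hash table), a block hash function $h$ from keys to $\{0,\dots,m/B-1\}$, a threshold hash function $\delta$ from keys to $\{0,\dots,\hat{t}-1\}$, and a metadata array $M[0..m/B]$ storing for each block $i$ an offset $o_i\in\{0,\dots,\hat{o}\}$, a gap $g_i\in\{0,\dots,\hat{B}\}$ and a threshold $t_i\in\{0,\dots,\hat{t}\}$ (initially $(0,B,0)$ for each block and a sentinel $(0,0,0)$ in $M[m/B]$). Block $i$ occupies the contiguous range $\mathrm{blockRange}(i)=\{Bi+o_i,\dots,Bi+B+o_{i+1}-g_i-1\}$ of $T$, followed by $g_i$ unused cells; it has at most $\hat{B}$ elements. An element with key $k$ is bumped (stored in $T'$) iff $\delta(k)<t_{h(k)}$; otherwise it is stored in $\mathrm{blockRange}(h(k))$. Operation $\mathrm{insert}(e)$ with key $k$, $i=h(k)$: if $\delta(k)<t_i$, insert $e$ into $T'$ and stop; if $k$ is already in block $i$, stop. If block $i$ has $\hat{B}$ elements, or $g_i=0$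 and neither sliding procedure succeeds, then set $t_i$ to $1+\min$ of $\delta$ over $k$ and the keys in block $i$, move all elements of block $i$ with $\delta<t_i$ to $T'$ (filling each hole with the block's last element and incrementing $g_i$), and if $\delta(k)<t_i$ insert $e$ into $T'$ and stop. Finally decrement $g_i$ and write $e$ into the new last cell of block $i$. The sliding procedure to the right scans blocks $i, i+1,\dots$ until it finds one with nonzero gap (failing if it reaches the last block or a block with offset $\hat{o}$), then moves the free slot towards block $i$ by moving, for each intermediate block, its first element to just after its end and incrementing its offset; sliding left is symmetric (failing at a block with offset $0$, moving each block's last element to the previous block's free slot and decrementing its offset). -}

module Defs where

open import Data.Nat using (ℕ; zero; suc; _+_; _*_; _∸_; _≤_; _<_; _<ᵇ_; _≡ᵇ_)
open import Data.Bool using (Bool; true; false; if_then_else_)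
open import Data.Product using (_×_; _,_; proj₁; proj₂)
open import Data.Maybe using (Maybe; just; nothing)
open import Relation.Binary.Definitions using (DecidableEquality)
open import Relation.Nullary.Decidable using (⌊_⌋)
open import Relation.Binary.PropositionalEquality using (_≡_)

-- Parameters of a Slick hash table.
--   nb = m / B  (number of blocks; the main array has m = nb * B cells)
--   B, B̂ (max elements per block), ô (max offset), t̂ (threshold range)

record Params : Set where
  constructor params
  field
    nb B B̂ ô t̂ : ℕ

record Meta : Set where
  constructor meta
  field
    off gap thr : ℕ

-- The backyard is an arbitrary hash table: an abstract state type with an
-- insertion operation that also reports the time it spent.
record Backyard (E : Set) : Set₁ where
  field
    Y   : Set
    ins : E → Y → Y × ℕ

record Table (E Y : Set) : Set where
  constructor table
  field
    T  : ℕ → E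
    M  : ℕ → Meta
    Tʹ : Y

-- Cost accounting of one operation:
--   time = total number of unit-cost word-RAM steps, INCLUDING time spent
--          in the backyard;
--   tb   = T_bump, time spent on operations in the backyard;
--   s    = number of blocks considered by the sliding procedures.
record Cost : Set where
  constructor cost
  field
    time tb s : ℕ

_⊕_ : Cost → Cost → Cost
cost a b c ⊕ cost a' b' c' = cost (a + a') (b + b') (c + c')

tick : Cost
tick = cost 1 0 0

upd : {A : Set} → (ℕ → A) → ℕ → A → ℕ → A
upd f p a q = if q ≡ᵇ p then a else f q

minℕ : ℕ → ℕ → ℕ
minℕ a b = if a <ᵇ b then a else b

module SlickOps {K V : Set} (_≟_ : DecidableEquality K) (P : Params)
                (BY : Backyard (K × V)) (h δ : K → ℕ) where

  open Params P
  open Backyard BY using (Y; ins)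

  E : Set
  E = K × V

  key : E → K
  key = proj₁

  Tab : Set
  Tab = Table E Y

  -- blockRange(i) = { B i + o_i , … , B i + B + o_{i+1} - g_i - 1 }
  blockStart : (ℕ → Meta) → ℕ → ℕ
  blockStart M i = B * i + Meta.off (M i)

  -- one past the last cell of block i
  blockEnd : (ℕ → Meta) → ℕ → ℕ
  blockEnd M i = (B * suc i + Meta.off (M (suc i))) ∸ Meta.gap (M i)

  blockSize : (ℕ → Meta) → ℕ → ℕ
  blockSize M i = blockEnd M i ∸ blockStart M i

  setOff setGap setThr : (ℕ → Meta) → ℕ → ℕ → ℕ → Meta
  setOff M i x = upd M i (meta x (Meta.gap (M i)) (Meta.thr (M i)))
  setGap M i x = upd M i (meta (Meta.off (M i)) x (Meta.thr (M i)))
  setThr M i x = upd M i (meta (Meta.off (M i)) (Meta.gap (M i)) x)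

  memberLoop : (ℕ → E) → K → ℕ → ℕ → Bool × Cost
  memberLoop T k zero p = false , tick
  memberLoop T k (suc n) p with ⌊ k ≟ key (T p) ⌋
  ... | true  = true , tick
  ... | false = let r = memberLoop T k n (suc p) in proj₁ r , (tick ⊕ proj₂ r)

  minLoop : (ℕ → E) → ℕ → ℕ → ℕ → ℕ × Cost
  minLoop T acc zero p = acc , tick
  minLoop T acc (suc n) p =
    let r = minLoop T (minℕ acc (δ (key (T p)))) n (suc p) in proj₁ r , (tick ⊕ proj₂ r)

  -- move all elements of block i with δ < t to the backyard, filling each
  -- hole with the block's last element and incrementing g_i.
  -- (fuel n; each step either advances p or shrinks the block)
  bumpLoop : ℕ → ℕ → ℕ → ℕ → Tab → Tab × Cost
  bumpLoop i t zero p st = st , tick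
  bumpLoop i t (suc n) p (table T M Y₀) =
    if p <ᵇ blockEnd M i
    then (if δ (key (T p)) <ᵇ t
          then (let r   = ins (T p) Y₀
                    e   = blockEnd M i
                    T'  = upd T p (T (e ∸ 1))
                    M'  = setGap M i (suc (Meta.gap (M i)))
                    rr  = bumpLoop i t n p (table T' M' (proj₁ r))
                in proj₁ rr , (cost (1 + proj₂ r) (proj₂ r) 0 ⊕ proj₂ rr))
          else (let rr = bumpLoop i t n (suc p) (table T M Y₀)
                in proj₁ rr , (tick ⊕ proj₂ rr)))
    else (table T M Y₀ , tick)

  -- sliding to the right: scan blocks j, j+1, … for a nonzero gap.
  -- Each visited block costs one step and counts as one considered block.
  scanR : (ℕ → Meta) → ℕ → ℕ → Maybe ℕ × Cost
  scanR M zero j = nothing , cost 1 0 1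
  scanR M (suc n) j =
    if 0 <ᵇ Meta.gap (M j) then (just j , cost 1 0 1)
    else if nb ≤ᵇ' suc j then (nothing , cost 1 0 1)
    else if Meta.off (M (suc j)) ≡ᵇ ô then (nothing , cost 1 0 1)
    else (let r = scanR M n (suc j) in proj₁ r , (cost 1 0 1 ⊕ proj₂ r))
    where
      _≤ᵇ'_ : ℕ → ℕ → Bool
      a ≤ᵇ' b = a <ᵇ suc b

  -- move the first element of block j to just after its end, increment o_j
  -- (the freed cell becomes gap of block j-1)
  moveFirst : ℕ → Tab → Tab
  moveFirst j (table T M Y₀) =
    let a  = blockStart M j
        b  = blockEnd M j
        T' = upd T b (T a)
        M1 = setOff M j (suc (Meta.off (M j)))
        M2 = setGap M1 j (Meta.gap (M j) ∸ 1)
        M3 = setGap M2 (j ∸ 1) (suc (Meta.gap (M (j ∸ 1))))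
    in table T' M3 Y₀

  shiftR : ℕ → ℕ → Tab → Tab × Cost
  shiftR zero j st = st , tick
  shiftR (suc d) j st =
    let r = shiftR d (j ∸ 1) (moveFirst j st) in proj₁ r , (tick ⊕ proj₂ r)

  scanL : (ℕ → Meta) → ℕ → ℕ → Maybe ℕ × Cost
  scanL M zero j = nothing , cost 1 0 1
  scanL M (suc n) j =
    if 0 <ᵇ Meta.gap (M j) then (just j , cost 1 0 1)
    else if Meta.off (M j) ≡ᵇ 0 then (nothing , cost 1 0 1)
    else if j ≡ᵇ 0 then (nothing , cost 1 0 1)
    else (let r = scanL M n (j ∸ 1) in proj₁ r , (cost 1 0 1 ⊕ proj₂ r))

  moveLast : ℕ → Tab → Tab
  moveLast j (table T M Y₀) =
    let a  = blockStart M j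
        b  = blockEnd M j
        T' = upd T (a ∸ 1) (T (b ∸ 1))
        M1 = setOff M j (Meta.off (M j) ∸ 1)
        M2 = setGap M1 j (suc (Meta.gap (M j)))
        M3 = setGap M2 (j ∸ 1) (Meta.gap (M (j ∸ 1)) ∸ 1)
    in table T' M3 Y₀

  shiftL : ℕ → ℕ → Tab → Tab × Cost
  shiftL zero j st = st , tick
  shiftL (suc d) j st =
    let r = shiftL d (suc j) (moveLast j st) in proj₁ r , (tick ⊕ proj₂ r)

  write : ℕ → E → Tab → Tab × Cost
  write i e (table T M Y₀) =
    table (upd T (blockEnd M i) e) (setGap M i (Meta.gap (M i) ∸ 1)) Y₀ , tick

  toBackyard : E → Tab → Tab × Cost
  toBackyard e (table T M Y₀) =
    let r = ins e Y₀ in table T M (proj₁ r) , cost (1 + proj₂ r) (proj₂ r) 0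

  bump : ℕ → E → Tab → Tab × Cost
  bump i e (table T M Y₀) =
    let k   = key e
        mn  = minLoop T (δ k) (blockSize M i) (blockStart M i)
        t   = suc (proj₁ mn)
        M'  = setThr M i t
        bl  = bumpLoop i t (blockSize M i) (blockStart M i) (table T M' Y₀)
        fin = if δ k <ᵇ t then toBackyard e (proj₁ bl) else write i e (proj₁ bl)
    in proj₁ fin , (proj₂ mn ⊕ (proj₂ bl ⊕ proj₂ fin))

  insert : Tab → E → Tab × Cost
  insert (table T M Y₀) e =
    let k = key e
        i = h k
        st = table T M Y₀
    in
    if δ k <ᵇ Meta.thr (M i) then toBackyard e st
    else
      (let mem = memberLoop T k (blockSize M i) (blockStart M i) in
       if proj₁ mem then (st , proj₂ mem)
       else (let r = rest i e st in proj₁ r , (proj₂ mem ⊕ proj₂ r)))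
    where
      rest : ℕ → E → Tab → Tab × Cost
      rest i e st@(table T M Y₀) =
        if blockSize M i ≡ᵇ B̂ then bump i e st
        else if 0 <ᵇ Meta.gap (M i) then write i e st
        else
          (let sr = scanR M nb i in
           go₁ (proj₁ sr) (proj₂ sr))
        where
          go₂ : Maybe ℕ → Cost → Cost → Tab × Cost
          go₂ (just j) c₁ c₂ =
            let sh = shiftL (i ∸ j) (suc j) st
                w  = write i e (proj₁ sh)
            in proj₁ w , (c₁ ⊕ (c₂ ⊕ (proj₂ sh ⊕ proj₂ w)))
          go₂ nothing c₁ c₂ =
            let b = bump i e st in proj₁ b , (c₁ ⊕ (c₂ ⊕ proj₂ b))

          go₁ : Maybe ℕ → Cost → Tab × Cost
          go₁ (just j) c =
            let sh = shiftR (j ∸ i) j st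
                w  = write i e (proj₁ sh)
            in proj₁ w , (c ⊕ (proj₂ sh ⊕ proj₂ w))
          go₁ nothing c =
            let sl = scanL M (suc i) i in go₂ (proj₁ sl) c (proj₂ sl)

  record Valid (st : Tab) : Set where
    field
      h-range   : ∀ k → h k < nb
      δ-range   : ∀ k → δ k < t̂
      off-range : ∀ i → i < nb → Meta.off (Table.M st i) ≤ ô
      gap-range : ∀ i → i < nb → Meta.gap (Table.M st i) ≤ B̂
      thr-range : ∀ i → i < nb → Meta.thr (Table.M st i) ≤ t̂
      sentinel  : Table.M st nb ≡ meta 0 0 0
      size-ok   : ∀ i → i < nb → blockSize (Table.M st) i ≤ B̂

{-# OPTIONS --safe #-}
-- Every step of an insertion is charged to one of three accounts. The loops
-- over the home block (membership test, minimum of δ, bumping) run at most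
-- once per element, i.e. O(B̂) steps; every backyard insertion is paid by
-- T_bump plus one step; a scan spends one step per considered block, and the
-- following shift moves one element per block between the home block and the
-- free slot, hence at most one more step per considered block.
module Submission where

open import Defs
open import Data.Nat using (ℕ; zero; suc; _+_; _*_; _∸_; _≤_; _<_; _<ᵇ_; _≡ᵇ_; z≤n; s≤s)
open import Data.Nat.Properties
open import Data.Nat.Tactic.RingSolver using (solve-∀)
open import Data.Bool using (true; false; if_then_else_)
open import Data.Maybe using (Maybe; just; nothing)
open import Data.Product using (Σ; _×_; _,_; proj₁; proj₂)
open import Function using (_∘_)
open import Relation.Binary.Definitions using (DecidableEquality)
open import Relation.Binary.PropositionalEquality using (_≡_; refl; sym; cong; subst)
open import Relation.Nullary.Decidable using (⌊_⌋)

if-preserves : ∀ {A : Set} (P : A → Set) b {x y : A} → P x → P y → P (if b then x else y)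
if-preserves P true  px py = px
if-preserves P false px py = py

⊕-assoc : ∀ c d e → (c ⊕ d) ⊕ e ≡ c ⊕ (d ⊕ e)
⊕-assoc (cost a b c) (cost a' b' c') (cost a'' b'' c'')
  rewrite +-assoc a a' a'' | +-assoc b b' b'' | +-assoc c c' c'' = refl

record Within (a : ℕ) (c : Cost) : Set where
  constructor within
  field
    bound : Cost.time c ≤ a + 2 * Cost.s c + Cost.tb c

within-mono : ∀ {a b c} → a ≤ b → Within a c → Within b c
within-mono {c = c} a≤b (within w) =
  within (≤-trans w (+-monoˡ-≤ (Cost.tb c) (+-monoˡ-≤ (2 * Cost.s c) a≤b)))

within-⊕ : ∀ {a b c d} → Within a c → Within b d → Within (a + b) (c ⊕ d)
within-⊕ {a} {b} {c} {d} (within wc) (within wd) =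
  within (≤-trans (+-mono-≤ wc wd)
                  (≤-reflexive (regroup a b (Cost.s c) (Cost.tb c) (Cost.s d) (Cost.tb d))))
  where
  regroup : ∀ a b s t s′ t′ → (a + 2 * s + t) + (b + 2 * s′ + t′) ≡ (a + b) + 2 * (s + s′) + (t + t′)
  regroup = solve-∀

within-tick : Within 1 tick
within-tick = within ≤-refl

within-backyard : ∀ t → Within 1 (cost (1 + t) t 0)
within-backyard t = within ≤-refl

within-scan : ∀ k → Within 0 (cost k 0 k)
within-scan k = within (≤-trans (m≤m+n k k) (≤-reflexive (double k)))
  where
  double : ∀ k → k + k ≡ 0 + 2 * k + 0
  double = solve-∀

within-scan-shift : ∀ {d k} → d < k → Within 0 (cost k 0 k ⊕ cost (suc d) 0 0)
within-scan-shift {d} {k} d<k = within (≤-trans (+-monoʳ-≤ k d<k) (≤-reflexive (double k)))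
  where
  double : ∀ k → k + k ≡ 0 + 2 * (k + 0) + (0 + 0)
  double = solve-∀

slide-within : ∀ {d k sh w} → sh ≡ cost (suc d) 0 0 → d < k → Within 1 w →
               Within 1 (cost k 0 k ⊕ (sh ⊕ w))
slide-within {d} {k} {w = w} refl d<k ww =
  subst (Within 1) (⊕-assoc (cost k 0 k) (cost (suc d) 0 0) w)
    (within-⊕ (within-scan-shift d<k) ww)

-- `dist j` is the distance from the starting block to the block j found.
data ScanResult (dist : ℕ → ℕ) : Maybe ℕ × Cost → Set where
  failed : ∀ k → ScanResult dist (nothing , cost k 0 k)
  found  : ∀ {j} k → dist j < k → ScanResult dist (just j , cost k 0 k)

scanResult-here : ∀ {dist j} → dist j ≡ 0 → ScanResult dist (just j , cost 1 0 1)
scanResult-here dist≡0 = found 1 (s≤s (≤-reflexive dist≡0))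

scanResult-step : ∀ {dist dist′ r} → (∀ j → dist j ≤ suc (dist′ j)) →
                  ScanResult dist′ r → ScanResult dist (proj₁ r , cost 1 0 1 ⊕ proj₂ r)
scanResult-step step (failed k)    = failed (suc k)
scanResult-step step (found k d<k) = found (suc k) (≤-trans (s≤s (step _)) (s≤s d<k))

m∸n≤1+[m∸1+n] : ∀ m n → m ∸ n ≤ suc (m ∸ suc n)
m∸n≤1+[m∸1+n] zero    zero    = z≤n
m∸n≤1+[m∸1+n] zero    (suc n) = z≤n
m∸n≤1+[m∸1+n] (suc m) zero    = ≤-refl
m∸n≤1+[m∸1+n] (suc m) (suc n) = m∸n≤1+[m∸1+n] m n

m∸n≤1+[m∸1∸n] : ∀ m n → m ∸ n ≤ suc (m ∸ 1 ∸ n)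
m∸n≤1+[m∸1∸n] m n = subst (λ x → m ∸ n ≤ suc x) (sym (∸-+-assoc m 1 n)) (m∸n≤1+[m∸1+n] m n)

module _ {K V : Set} (_≟_ : DecidableEquality K) (P : Params)
         (BY : Backyard (K × V)) (h δ : K → ℕ) where
  open SlickOps _≟_ P BY h δ
  open Params P

  memberLoop-within : ∀ T k n p → Within (suc n) (proj₂ (memberLoop T k n p))
  memberLoop-within T k zero    p = within-tick
  memberLoop-within T k (suc n) p with ⌊ k ≟ key (T p) ⌋
  ... | true  = within-mono (s≤s z≤n) within-tick
  ... | false = within-⊕ within-tick (memberLoop-within T k n (suc p))

  minLoop-within : ∀ T acc n p → Within (suc n) (proj₂ (minLoop T acc n p))
  minLoop-within T acc zero    p = within-tick
  minLoop-within T acc (suc n) p = within-⊕ within-tick (minLoop-within T _ n (suc p))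

  bumpLoop-within : ∀ i t n p st → Within (suc n) (proj₂ (bumpLoop i t n p st))
  bumpLoop-within i t zero    p st             = within-tick
  bumpLoop-within i t (suc n) p (table T M Y₀) =
    if-preserves (Within (2 + n) ∘ proj₂) (p <ᵇ blockEnd M i)
      (if-preserves (Within (2 + n) ∘ proj₂) (δ (key (T p)) <ᵇ t)
        (within-⊕ (within-backyard _) (bumpLoop-within i t n p _))
        (within-⊕ within-tick (bumpLoop-within i t n (suc p) _)))
      (within-mono (s≤s z≤n) within-tick)

  toBackyard-within : ∀ e st → Within 1 (proj₂ (toBackyard e st))
  toBackyard-within e st = within-backyard _

  write-within : ∀ i e st → Within 1 (proj₂ (write i e st))
  write-within i e st = within-tick

  bump-within : ∀ i e T M Y₀ → Within (3 + 2 * blockSize M i) (proj₂ (bump i e (table T M Y₀)))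
  bump-within i e T M Y₀ =
    within-mono (≤-reflexive (count n))
      (within-⊕ (minLoop-within T (δ (key e)) n p)
        (within-⊕ (bumpLoop-within i t n p (table T (setThr M i t) Y₀))
          (if-preserves (Within 1 ∘ proj₂) (δ (key e) <ᵇ t)
            (toBackyard-within e bumped) (write-within i e bumped))))
    where
    n = blockSize M i
    p = blockStart M i
    t = suc (proj₁ (minLoop T (δ (key e)) n p))
    bumped = proj₁ (bumpLoop i t n p (table T (setThr M i t) Y₀))
    count : ∀ n → suc n + (suc n + 1) ≡ 3 + 2 * n
    count = solve-∀

  scanR-result : ∀ M n j → ScanResult (_∸ j) (scanR M n j)
  scanR-result M zero    j = failed 1
  scanR-result M (suc n) j =
    if-preserves (ScanResult (_∸ j)) (0 <ᵇ Meta.gap (M j)) (scanResult-here (n∸n≡0 j))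
      (if-preserves (ScanResult (_∸ j)) (nb <ᵇ suc (suc j)) (failed 1)
        (if-preserves (ScanResult (_∸ j)) (Meta.off (M (suc j)) ≡ᵇ ô) (failed 1)
          (scanResult-step (λ j′ → m∸n≤1+[m∸1+n] j′ j) (scanR-result M n (suc j)))))

  scanL-result : ∀ M n j → ScanResult (j ∸_) (scanL M n j)
  scanL-result M zero    j = failed 1
  scanL-result M (suc n) j =
    if-preserves (ScanResult (j ∸_)) (0 <ᵇ Meta.gap (M j)) (scanResult-here (n∸n≡0 j))
      (if-preserves (ScanResult (j ∸_)) (Meta.off (M j) ≡ᵇ 0) (failed 1)
        (if-preserves (ScanResult (j ∸_)) (j ≡ᵇ 0) (failed 1)
          (scanResult-step (m∸n≤1+[m∸1∸n] j) (scanL-result M n (j ∸ 1)))))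

  shiftR-cost : ∀ d j st → proj₂ (shiftR d j st) ≡ cost (suc d) 0 0
  shiftR-cost zero    j st = refl
  shiftR-cost (suc d) j st = cong (tick ⊕_) (shiftR-cost d (j ∸ 1) (moveFirst j st))

  shiftL-cost : ∀ d j st → proj₂ (shiftL d j st) ≡ cost (suc d) 0 0
  shiftL-cost zero    j st = refl
  shiftL-cost (suc d) j st = cong (tick ⊕_) (shiftL-cost d (suc j) (moveLast j st))

  module _ (T : ℕ → E) (M : ℕ → Meta) (Y₀ : Backyard.Y BY) (e : E) where
    private
      i = h (key e)
      n = blockSize M i
      st = table T M Y₀

    insert-within : Within (suc n + (3 + 2 * n)) (proj₂ (insert st e))
    insert-within with δ (key e) <ᵇ Meta.thr (M i)
    ... | true  = within-mono (s≤s z≤n) (toBackyard-within e st)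
    ... | false with memberLoop T (key e) n (blockStart M i) | memberLoop-within T (key e) n (blockStart M i)
    ... | true  , _ | member = within-mono (m≤m+n _ _) member
    ... | false , _ | member with n ≡ᵇ B̂
    ... | true = within-⊕ member (bump-within i e T M Y₀)
    ... | false with 0 <ᵇ Meta.gap (M i)
    ... | true = within-⊕ member (within-mono (s≤s z≤n) (write-within i e st))
    ... | false with scanR M nb i | scanR-result M nb i
    ... | _ | found {j} k d<k =
      within-⊕ member (within-mono (s≤s z≤n)
        (slide-within (shiftR-cost _ _ _) d<k (write-within i e (proj₁ (shiftR (j ∸ i) j st)))))
    ... | _ | failed k with scanL M (suc i) i | scanL-result M (suc i) i
    ... | _ | found {j} k′ d<k′ =
      within-⊕ member (within-mono (s≤s z≤n) (within-⊕ (within-scan k)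
        (slide-within (shiftL-cost _ _ _) d<k′ (write-within i e (proj₁ (shiftL (i ∸ j) (suc j) st))))))
    ... | _ | failed k′ =
      within-⊕ member (within-⊕ (within-scan k) (within-⊕ (within-scan k′) (bump-within i e T M Y₀)))

within⇒linear : ∀ {a b c} → a ≤ 5 * (1 + b) → Within a c →
                Cost.time c ≤ 5 * (1 + b + Cost.s c) + Cost.tb c
within⇒linear {a} {b} {c} a≤5[1+b] (within w) = ≤-trans w (+-monoˡ-≤ (Cost.tb c) (begin
  a + 2 * Cost.s c          ≤⟨ +-mono-≤ a≤5[1+b] (*-monoˡ-≤ (Cost.s c) {2} {5} (s≤s (s≤s z≤n))) ⟩
  5 * (1 + b) + 5 * Cost.s c ≡⟨ *-distribˡ-+ 5 (1 + b) (Cost.s c) ⟨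
  5 * (1 + b + Cost.s c)     ∎))
  where open ≤-Reasoning

insert-budget≤ : ∀ {n b} → n ≤ b → suc n + (3 + 2 * n) ≤ 5 * (1 + b)
insert-budget≤ {n} {b} n≤b = begin
  suc n + (3 + 2 * n) ≡⟨ regroup n ⟩
  4 + 3 * n           ≤⟨ +-mono-≤ (n≤1+n 4) (*-monoʳ-≤ 3 n≤b) ⟩
  5 + 3 * b           ≤⟨ +-monoʳ-≤ 5 (*-monoˡ-≤ b {3} {5} (s≤s (s≤s (s≤s z≤n)))) ⟩
  5 + 5 * b           ≡⟨ *-distribˡ-+ 5 1 b ⟨
  5 * (1 + b)         ∎
  where
  open ≤-Reasoning
  regroup : ∀ n → suc n + (3 + 2 * n) ≡ 4 + 3 * n
  regroup = solve-∀

insert-time : ∀ {K V : Set} (_≟_ : DecidableEquality K) (P : Params)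
              (BY : Backyard (K × V)) (h δ : K → ℕ)
              (st : Table (K × V) (Backyard.Y BY)) (e : K × V) →
              SlickOps.Valid _≟_ P BY h δ st →
              let r = proj₂ (SlickOps.insert _≟_ P BY h δ st e) in
              Cost.time r ≤ 5 * (1 + Params.B̂ P + Cost.s r) + Cost.tb r
insert-time _≟_ P BY h δ (table T M Y₀) e valid =
  within⇒linear (insert-budget≤ (size-ok (h (proj₁ e)) (h-range (proj₁ e))))
    (insert-within _≟_ P BY h δ T M Y₀ e)
  where open SlickOps.Valid valid

corollary1 : Σ ℕ λ c →
    ∀ {K V : Set} (_≟_ : DecidableEquality K) (P : Params)
      (BY : Backyard (K × V)) (h δ : K → ℕ)
      (st : Table (K × V) (Backyard.Y BY)) (e : K × V) →
      SlickOps.Valid _≟_ P BY h δ st →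
      let r = proj₂ (SlickOps.insert _≟_ P BY h δ st e) in
      Cost.time r ≤ c * (1 + Params.B̂ P + Cost.s r) + Cost.tb r
corollary1 = 5 , insert-time
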